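{- Let $m\ge1$ and $n$ be integers and let $X=\mathrm{sk}(m,n)$. A set partition $\Phi$ of $[n]$ is a fundamental inflator of $X$ if and only if every block $\Phi_i$ of $\Phi$ satisfies $|\Phi_i|=1$ or $|\Phi_i|>m$.
   Context: $\mathrm{sk}(m,n)$ is the simplicial complex on $[n]$ whose faces are all subsets of $[n]$ of cardinality at most $m$. For a simplicial complex $X$ on $[n]$ and $S\subseteq[n]$, $X|_S=\{\sigma\in X:\sigma\subseteq S\}$; for a set partition $\Phi=\{\Phi_1,\dots,\Phi_k\}$ of $[n]$, $X_\Phi=\{\sigma_1\cup\cdots\cup\sigma_k:\sigma_i\in X,\sigma_i\subseteq\Phi_i\}$. For a complex $Y$, $\mathrm{Supp}_X(Y)=\{\Phi:X_\Phi=Y\}$; when nonempty it has a unique finest element (under refinement), the fundamental inflator $\mathrm{FInf}_X(Y)$. A partition $\Phi$ is a fundamental inflator of $X$ if $\Phi=\mathrm{FInf}_X(Y)$ for some $Y$, equivalently $\Phi$ is the finest element of $\mathrm{Supp}_X(X_\Phi)$. -}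

module Defs where

open import Level using (0ℓ)
open import Data.Nat using (ℕ; _≤_; _<_)
open import Data.Fin using (Fin; _≟_)
open import Data.Fin.Subset using (Subset; _∈_; _⊆_; ∣_∣)
open import Data.Vec using (tabulate)
open import Data.Product using (Σ; ∃; _×_)
open import Data.Sum using (_⊎_)
open import Relation.Nullary using (does)
open import Relation.Binary.PropositionalEquality using (_≡_)
open import Function.Bundles using (_⇔_)

Complex : ℕ → Set₁
Complex n = Subset n → Set

sk : (m n : ℕ) → Complex n
sk m n σ = ∣ σ ∣ ≤ m

_≃C_ : ∀ {n} → Complex n → Complex n → Set
_≃C_ {n} X Y = (σ : Subset n) → X σ ⇔ Y σ

-- A set partition of [n] is represented by a block-labelling f : [n] → [n];
-- the blocks are the nonempty fibres of f. Two labellings represent the same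
-- partition iff they have the same kernel (i ~ j iff f i ≡ f j).
Partition : ℕ → Set
Partition n = Fin n → Fin n

fibre : ∀ {n} → Partition n → Fin n → Subset n
fibre f k = tabulate (λ j → does (f j ≟ k))

blockOf : ∀ {n} → Partition n → Fin n → Subset n
blockOf f i = fibre f (f i)

_≼_ : ∀ {n} → Partition n → Partition n → Set
_≼_ {n} f g = (i j : Fin n) → f i ≡ f j → g i ≡ g j

-- X_Φ = { σ_1 ∪ ... ∪ σ_k : σ_i ∈ X, σ_i ⊆ Φ_i }. The family τ is indexed by
-- labels; labels with empty fibre force τ k = ∅ (∅ ∈ X for the complexes here).
inflate : ∀ {n} → Complex n → Partition n → Complex n
inflate {n} X f σ =
  Σ (Fin n → Subset n) λ τ →
    ((k : Fin n) → X (τ k)) ×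
    ((k : Fin n) → τ k ⊆ fibre f k) ×
    ((i : Fin n) → (i ∈ σ) ⇔ ∃ (λ k → i ∈ τ k))

InSupp : ∀ {n} → Complex n → Complex n → Partition n → Set
InSupp X Y f = inflate X f ≃C Y

IsFInf : ∀ {n} → Complex n → Complex n → Partition n → Set
IsFInf {n} X Y f = InSupp X Y f × ((g : Partition n) → InSupp X Y g → f ≼ g)

IsFundamentalInflator : ∀ {n} → Complex n → Partition n → Set₁
IsFundamentalInflator {n} X f = Σ (Complex n) λ Y → IsFInf X Y f

{-# OPTIONS --safe #-}
-- A face σ lies in sk(m,n)_Φ exactly when it meets every block of Φ in at most m points.
-- If a block B with 2 ≤ |B| ≤ m contains i, splitting i off into a new singleton block
-- does not change this condition (the bound on B itself is automatic), so Φ is not the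
-- finest partition with its inflation. Conversely, if every block is a singleton or has
-- more than m elements and Ψ separates two points i, j of a block B of Φ, then an
-- (m+1)-subset of B containing i and j lies in sk(m,n)_Ψ but not in sk(m,n)_Φ; hence
-- Φ is the finest element of Supp(sk(m,n)_Φ).
module Submission where

open import Defs
open import Data.Nat using (ℕ; _≤_; _<_)
open import Data.Fin using (Fin)
open import Data.Fin.Subset using (∣_∣)
open import Data.Sum using (_⊎_)
open import Relation.Binary.PropositionalEquality using (_≡_)
open import Function.Bundles using (_⇔_)

open import Data.Bool using (true; false)
open import Data.Empty using (⊥-elim)
open import Data.Fin using (punchOut) renaming (_≟_ to _≟ᶠ_)
open import Data.Fin.Properties using (any?; all?; ¬∀⟶∃¬; punchOut-injective; injective⇒≤)
open import Data.Fin.Subset using (Subset; _∈_; _∉_; _⊆_; _∩_; _∪_; ⁅_⁆)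
open import Data.Fin.Subset.Properties
open import Data.Nat using (zero; suc; z≤n; s≤s; _+_; _≟_; _<?_)
open import Data.Nat.Properties
  using ( module ≤-Reasoning; ≤-trans; ≤-reflexive; ≤∧≢⇒<; ≤-pred; n≤1+n; +-suc; +-monoʳ-≤
        ; ≮⇒≥; 1+n≰n; <-irrefl)
open import Data.Product using (∃; _×_; _,_; proj₁; proj₂; map₂)
open import Data.Sum using (inj₁; inj₂)
open import Data.Vec using (_∷_; []; here)
open import Data.Vec.Properties using (lookup∘tabulate; []=⇒lookup; lookup⇒[]=)
open import Function using (_∘_)
open import Function.Bundles using (mk⇔; Equivalence)
import Function.Properties.Equivalence as ⇔
open import Relation.Binary.PropositionalEquality
  using (_≢_; refl; sym; trans; cong; cong₂; subst; module ≡-Reasoning)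
open import Relation.Nullary using (¬_; yes; no; proof; invert; contradiction)
open import Relation.Nullary.Decidable using (dec-true; _×-dec_; ¬?)
open import Relation.Nullary.Reflects using (Reflects)

open Equivalence using (to; from)

∈fibre⁻ : ∀ {n} (f : Partition n) {x k} → x ∈ fibre f k → f x ≡ k
∈fibre⁻ f {x} {k} x∈ =
  invert (subst (Reflects _) (trans (sym (lookup∘tabulate _ x)) ([]=⇒lookup x∈)) (proof (f x ≟ᶠ k)))

∈fibre⁺ : ∀ {n} (f : Partition n) {x k} → f x ≡ k → x ∈ fibre f k
∈fibre⁺ f {x} {k} fx≡k = lookup⇒[]= x _ (trans (lookup∘tabulate _ x) (dec-true (f x ≟ᶠ k) fx≡k))

fibre-⊆ : ∀ {n} (f g : Partition n) {k l} → (∀ {x} → f x ≡ k → g x ≡ l) → fibre f k ⊆ fibre g l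
fibre-⊆ f g f⇒g x∈ = ∈fibre⁺ g (f⇒g (∈fibre⁻ f x∈))

p⊆q⇒∣r∩p∣≤∣r∩q∣ : ∀ {n} {p q : Subset n} (r : Subset n) → p ⊆ q → ∣ r ∩ p ∣ ≤ ∣ r ∩ q ∣
p⊆q⇒∣r∩p∣≤∣r∩q∣ {p = p} r p⊆q = p⊆q⇒∣p∣≤∣q∣ λ x∈ →
  let x∈r , x∈p = x∈p∩q⁻ r p x∈ in x∈p∩q⁺ (x∈r , p⊆q x∈p)

y∈p∧y∉q⇒∣p∩q∣<∣p∣ : ∀ {n} {p q : Subset n} {y} → y ∈ p → y ∉ q → ∣ p ∩ q ∣ < ∣ p ∣
y∈p∧y∉q⇒∣p∩q∣<∣p∣ {p = p} {q} y∈p y∉q =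
  p⊂q⇒∣p∣<∣q∣ (p∩q⊆p p q , _ , y∈p , y∉q ∘ proj₂ ∘ x∈p∩q⁻ p q)

x∈p∧y∈p∧x≢y⇒1<∣p∣ : ∀ {n} {p : Subset n} {x y} → x ∈ p → y ∈ p → x ≢ y → 1 < ∣ p ∣
x∈p∧y∈p∧x≢y⇒1<∣p∣ {x = x} x∈p y∈p x≢y = subst (_< _) (∣⁅x⁆∣≡1 x)
  (p⊂q⇒∣p∣<∣q∣ ((λ z∈ → subst (_∈ _) (sym (x∈⁅y⁆⇒x≡y x z∈)) x∈p) , _ , y∈p , x≢y ∘ sym ∘ x∈⁅y⁆⇒x≡y x))

∃-otherMember : ∀ {n} {p : Subset n} {x} → x ∈ p → ∣ p ∣ ≢ 1 → ∃ λ y → y ∈ p × y ≢ x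
∃-otherMember {p = p} {x} x∈p ∣p∣≢1 with any? (λ y → (y ∈? p) ×-dec ¬? (y ≟ᶠ x))
... | yes other = other
... | no ∄other = ⊥-elim (∣p∣≢1 (trans (cong ∣_∣ (⊆-antisym p⊆⁅x⁆ ⁅x⁆⊆p)) (∣⁅x⁆∣≡1 x)))
  where
  p⊆⁅x⁆ : p ⊆ ⁅ x ⁆
  p⊆⁅x⁆ {y} y∈p with y ≟ᶠ x
  ... | yes refl = x∈⁅x⁆ x
  ... | no y≢x = ⊥-elim (∄other (y , y∈p , y≢x))
  ⁅x⁆⊆p : ⁅ x ⁆ ⊆ p
  ⁅x⁆⊆p y∈ = subst (_∈ p) (sym (x∈⁅y⁆⇒x≡y x y∈)) x∈p

∣p∪q∣≤∣p∣+∣q∣ : ∀ {n} (p q : Subset n) → ∣ p ∪ q ∣ ≤ ∣ p ∣ + ∣ q ∣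
∣p∪q∣≤∣p∣+∣q∣ [] [] = z≤n
∣p∪q∣≤∣p∣+∣q∣ (true ∷ p) (true ∷ q) = s≤s (≤-trans (∣p∪q∣≤∣p∣+∣q∣ p q) (+-monoʳ-≤ ∣ p ∣ (n≤1+n _)))
∣p∪q∣≤∣p∣+∣q∣ (true ∷ p) (false ∷ q) = s≤s (∣p∪q∣≤∣p∣+∣q∣ p q)
∣p∪q∣≤∣p∣+∣q∣ (false ∷ p) (true ∷ q) = ≤-trans (s≤s (∣p∪q∣≤∣p∣+∣q∣ p q)) (≤-reflexive (sym (+-suc _ _)))
∣p∪q∣≤∣p∣+∣q∣ (false ∷ p) (false ∷ q) = ∣p∪q∣≤∣p∣+∣q∣ p q

∃-sizedSubsetBetween : ∀ {n} k {A T : Subset n} → A ⊆ T → ∣ A ∣ ≤ k → k ≤ ∣ T ∣ →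
  ∃ λ U → A ⊆ U × U ⊆ T × ∣ U ∣ ≡ k
∃-sizedSubsetBetween zero {[]} {[]} _ _ _ = [] , (λ ()) , (λ ()) , refl
∃-sizedSubsetBetween k {true ∷ A} {false ∷ T} A⊆T _ _ with () ← A⊆T here
∃-sizedSubsetBetween (suc k) {true ∷ A} {true ∷ T} A⊆T (s≤s A≤k) (s≤s k≤T)
  with U , A⊆U , U⊆T , ∣U∣≡k ← ∃-sizedSubsetBetween k (drop-∷-⊆ A⊆T) A≤k k≤T
  = true ∷ U , s⊆s A⊆U , s⊆s U⊆T , cong suc ∣U∣≡k
∃-sizedSubsetBetween k {false ∷ A} {false ∷ T} A⊆T A≤k k≤T
  with U , A⊆U , U⊆T , ∣U∣≡k ← ∃-sizedSubsetBetween k (drop-∷-⊆ A⊆T) A≤k k≤T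
  = false ∷ U , s⊆s A⊆U , s⊆s U⊆T , ∣U∣≡k
∃-sizedSubsetBetween k {false ∷ A} {true ∷ T} A⊆T A≤k k≤1+T with k ≟ suc ∣ T ∣
... | yes refl = true ∷ T , A⊆T , ⊆-refl , refl
... | no k≢1+T
  with U , A⊆U , U⊆T , ∣U∣≡k ← ∃-sizedSubsetBetween k (drop-∷-⊆ A⊆T) A≤k (≤-pred (≤∧≢⇒< k≤1+T k≢1+T))
  = false ∷ U , s⊆s A⊆U , out⊆ U⊆T , ∣U∣≡k

section⇒surjective : ∀ {n} {f h : Fin n → Fin n} → (∀ l → f (h l) ≡ l) → ∀ y → ∃ λ l → h l ≡ y
section⇒surjective {suc n} {f} {h} f∘h≡id y with any? (λ l → h l ≟ᶠ y)
... | yes hit = hit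
... | no ∄hit = contradiction (injective⇒≤ punchOut∘h-injective) 1+n≰n
  where
  h≢y : ∀ l → y ≢ h l
  h≢y l y≡hl = ∄hit (l , sym y≡hl)
  punchOut∘h-injective : ∀ {a b} → punchOut (h≢y a) ≡ punchOut (h≢y b) → a ≡ b
  punchOut∘h-injective {a} {b} eq =
    trans (sym (f∘h≡id a)) (trans (cong f (punchOut-injective (h≢y a) (h≢y b) eq)) (f∘h≡id b))

surjective⇒injective : ∀ {n} {f : Fin n → Fin n} → (∀ l → ∃ λ x → f x ≡ l) →
  ∀ {i j} → f i ≡ f j → i ≡ j
surjective⇒injective {f = f} surj {i} {j} fi≡fj =
  trans (sym (h∘f≡id i)) (trans (cong h fi≡fj) (h∘f≡id j))
  where
  h : Fin _ → Fin _
  h = proj₁ ∘ surj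
  f∘h≡id : ∀ l → f (h l) ≡ l
  f∘h≡id = proj₂ ∘ surj
  h∘f≡id : ∀ x → h (f x) ≡ x
  h∘f≡id x with section⇒surjective {f = f} {h} f∘h≡id x
  ... | a , refl = cong h (f∘h≡id a)

∃-missedValue : ∀ {n} {f : Fin n → Fin n} {i j} → f i ≡ f j → i ≢ j → ∃ λ l → ∀ x → f x ≢ l
∃-missedValue {n} {f} fi≡fj i≢j with all? (λ l → any? (λ x → f x ≟ᶠ l))
... | yes surj = ⊥-elim (i≢j (surjective⇒injective surj fi≡fj))
... | no ¬surj = map₂ (λ ∄x x fx≡l → ∄x (x , fx≡l)) (¬∀⟶∃¬ n _ (λ l → any? (λ x → f x ≟ᶠ l)) ¬surj)

FibresBounded : ∀ {n} → ℕ → Partition n → Subset n → Set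
FibresBounded {n} m f σ = (k : Fin n) → ∣ σ ∩ fibre f k ∣ ≤ m

inflate-sk⇔fibresBounded : ∀ {m n} (f : Partition n) (σ : Subset n) →
  inflate (sk m n) f σ ⇔ FibresBounded m f σ
inflate-sk⇔fibresBounded {m} {n} f σ = mk⇔ bounded face
  where
  bounded : inflate (sk m n) f σ → FibresBounded m f σ
  bounded (τ , τ∈sk , τ⊆fibre , σ≡⋃τ) k = ≤-trans (p⊆q⇒∣p∣≤∣q∣ σ∩fibre⊆τ) (τ∈sk k)
    where
    σ∩fibre⊆τ : σ ∩ fibre f k ⊆ τ k
    σ∩fibre⊆τ {x} x∈
      with x∈σ , x∈fibre ← x∈p∩q⁻ σ (fibre f k) x∈
      with l , x∈τl ← to (σ≡⋃τ x) x∈σ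
      = subst (λ l → x ∈ τ l) (trans (sym (∈fibre⁻ f (τ⊆fibre l x∈τl))) (∈fibre⁻ f x∈fibre)) x∈τl
  face : FibresBounded m f σ → inflate (sk m n) f σ
  face bounded = (λ k → σ ∩ fibre f k) , bounded , (λ k → p∩q⊆q σ (fibre f k)) ,
    λ x → mk⇔ (λ x∈σ → f x , x∈p∩q⁺ (x∈σ , ∈fibre⁺ f refl)) (λ (k , x∈) → proj₁ (x∈p∩q⁻ σ (fibre f k) x∈))

≼-fibresBounded : ∀ {m n} {f g : Partition n} {σ} → g ≼ f → FibresBounded m f σ → FibresBounded m g σ
≼-fibresBounded {f = f} {g} {σ} g≼f bounded k with any? (λ x → g x ≟ᶠ k)
... | yes (x , gx≡k) =
  ≤-trans (p⊆q⇒∣r∩p∣≤∣r∩q∣ σ (fibre-⊆ g f λ {y} gy≡k → g≼f y x (trans gy≡k (sym gx≡k)))) (bounded (f x))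
... | no ∄x = ≤-trans (p⊆q⇒∣r∩p∣≤∣r∩q∣ σ (fibre-⊆ g f λ {y} gy≡k → ⊥-elim (∄x (y , gy≡k)))) (bounded k)

isolate : ∀ {n} → Partition n → Fin n → Fin n → Partition n
isolate f i l x with x ≟ᶠ i
... | yes _ = l
... | no _ = f x

isolate-≡ : ∀ {n} {f : Partition n} {i l} → isolate f i l i ≡ l
isolate-≡ {i = i} with i ≟ᶠ i
... | yes _ = refl
... | no i≢i = ⊥-elim (i≢i refl)

isolate-≢ : ∀ {n} {f : Partition n} {i l x} → x ≢ i → isolate f i l x ≡ f x
isolate-≢ {i = i} {x = x} x≢i with x ≟ᶠ i
... | yes x≡i = ⊥-elim (x≢i x≡i)
... | no _ = refl

isolate-≼ : ∀ {n} {f : Partition n} {i l} → (∀ x → f x ≢ l) → isolate f i l ≼ f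
isolate-≼ {i = i} l∉f x y gx≡gy with x ≟ᶠ i | y ≟ᶠ i
... | yes refl | yes refl = refl
... | yes _ | no _ = ⊥-elim (l∉f y (sym gx≡gy))
... | no _ | yes _ = ⊥-elim (l∉f x gx≡gy)
... | no _ | no _ = gx≡gy

isolate-fibresBounded : ∀ {m n} {f : Partition n} {i l σ} → ∣ blockOf f i ∣ ≤ m →
  FibresBounded m (isolate f i l) σ → FibresBounded m f σ
isolate-fibresBounded {f = f} {i} {l} {σ} small bounded k with k ≟ᶠ f i
... | yes refl = ≤-trans (∣p∩q∣≤∣q∣ σ _) small
... | no k≢fi = ≤-trans (p⊆q⇒∣r∩p∣≤∣r∩q∣ σ (fibre-⊆ f (isolate f i l) unmoved)) (bounded k)
  where
  unmoved : ∀ {x} → f x ≡ k → isolate f i l x ≡ k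
  unmoved {x} fx≡k with x ≟ᶠ i
  ... | yes refl = ⊥-elim (k≢fi (sym fx≡k))
  ... | no _ = fx≡k

inflate-sk-isolate : ∀ {m n} {f : Partition n} {i l} → ∣ blockOf f i ∣ ≤ m → (∀ x → f x ≢ l) →
  inflate (sk m n) (isolate f i l) ≃C inflate (sk m n) f
inflate-sk-isolate {f = f} {i} {l} small l∉f σ =
  ⇔.trans (inflate-sk⇔fibresBounded (isolate f i l) σ)
    (⇔.trans (mk⇔ (isolate-fibresBounded {f = f} {i} {l} {σ} small)
                   (≼-fibresBounded {σ = σ} (isolate-≼ {f = f} l∉f)))
      (⇔.sym (inflate-sk⇔fibresBounded f σ)))

⁅x⁆∪⁅y⁆⊆p : ∀ {n} {p : Subset n} {x y} → x ∈ p → y ∈ p → ⁅ x ⁆ ∪ ⁅ y ⁆ ⊆ p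
⁅x⁆∪⁅y⁆⊆p {p = p} {x} {y} x∈p y∈p z∈ with x∈p∪q⁻ ⁅ x ⁆ ⁅ y ⁆ z∈
... | inj₁ z∈⁅x⁆ = subst (_∈ p) (sym (x∈⁅y⁆⇒x≡y x z∈⁅x⁆)) x∈p
... | inj₂ z∈⁅y⁆ = subst (_∈ p) (sym (x∈⁅y⁆⇒x≡y y z∈⁅y⁆)) y∈p

∣⁅x⁆∪⁅y⁆∣≤2 : ∀ {n} (x y : Fin n) → ∣ ⁅ x ⁆ ∪ ⁅ y ⁆ ∣ ≤ 2
∣⁅x⁆∪⁅y⁆∣≤2 x y = subst (∣ ⁅ x ⁆ ∪ ⁅ y ⁆ ∣ ≤_) (cong₂ _+_ (∣⁅x⁆∣≡1 x) (∣⁅x⁆∣≡1 y)) (∣p∪q∣≤∣p∣+∣q∣ ⁅ x ⁆ ⁅ y ⁆)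

∃-sizedSubsetContaining : ∀ {n} {p : Subset n} {x y} k → x ∈ p → y ∈ p → 2 ≤ k → k ≤ ∣ p ∣ →
  ∃ λ T → x ∈ T × y ∈ T × T ⊆ p × ∣ T ∣ ≡ k
∃-sizedSubsetContaining {x = x} {y} k x∈p y∈p 2≤k k≤∣p∣
  with T , xy⊆T , T⊆p , ∣T∣≡k
         ← ∃-sizedSubsetBetween k (⁅x⁆∪⁅y⁆⊆p x∈p y∈p) (≤-trans (∣⁅x⁆∪⁅y⁆∣≤2 x y) 2≤k) k≤∣p∣
  = T , xy⊆T (x∈p∪q⁺ (inj₁ (x∈⁅x⁆ x))) , xy⊆T (x∈p∪q⁺ (inj₂ (x∈⁅x⁆ y))) , T⊆p , ∣T∣≡k

separatingFace : ∀ {m n} {f g : Partition n} {i j T} → i ∈ T → j ∈ T → T ⊆ blockOf f i →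
  ∣ T ∣ ≡ suc m → g i ≢ g j → inflate (sk m n) g T × ¬ inflate (sk m n) f T
separatingFace {m} {f = f} {g} {i} {j} {T} i∈T j∈T T⊆B ∣T∣≡1+m gi≢gj =
  from (inflate-sk⇔fibresBounded g T) g-bounded ,
  f-unbounded ∘ to (inflate-sk⇔fibresBounded f T)
  where
  missing⇒≤m : ∀ {y q} → y ∈ T → y ∉ q → ∣ T ∩ q ∣ ≤ m
  missing⇒≤m y∈T y∉q = ≤-pred (subst (∣ T ∩ _ ∣ <_) ∣T∣≡1+m (y∈p∧y∉q⇒∣p∩q∣<∣p∣ y∈T y∉q))
  g-bounded : FibresBounded m g T
  g-bounded k with g i ≟ᶠ k
  ... | yes gi≡k = missing⇒≤m j∈T (λ j∈ → gi≢gj (trans gi≡k (sym (∈fibre⁻ g j∈))))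
  ... | no gi≢k = missing⇒≤m i∈T (gi≢k ∘ ∈fibre⁻ g)
  f-unbounded : ¬ FibresBounded m f T
  f-unbounded bounded = 1+n≰n (begin
    suc m                  ≡⟨ ∣T∣≡1+m ⟨
    ∣ T ∣                  ≤⟨ p⊆q⇒∣p∣≤∣q∣ (λ x∈T → x∈p∩q⁺ (x∈T , T⊆B x∈T)) ⟩
    ∣ T ∩ blockOf f i ∣    ≤⟨ bounded (f i) ⟩
    m                      ∎)
    where open ≤-Reasoning

largeBlocks⇒finest : ∀ {m n} {f g : Partition n} → 1 ≤ m →
  ((i : Fin n) → (∣ blockOf f i ∣ ≡ 1) ⊎ (m < ∣ blockOf f i ∣)) →
  inflate (sk m n) g ≃C inflate (sk m n) f → f ≼ g
largeBlocks⇒finest {f = f} {g} 1≤m blocks g≃f i j fi≡fj with g i ≟ᶠ g j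
... | yes gi≡gj = gi≡gj
... | no gi≢gj with blocks i
...   | inj₁ ∣B∣≡1 =
  ⊥-elim (<-irrefl (sym ∣B∣≡1) (x∈p∧y∈p∧x≢y⇒1<∣p∣ i∈B j∈B (gi≢gj ∘ cong g)))
  where
  i∈B : i ∈ blockOf f i
  i∈B = ∈fibre⁺ f refl
  j∈B : j ∈ blockOf f i
  j∈B = ∈fibre⁺ f (sym fi≡fj)
...   | inj₂ large
  with T , i∈T , j∈T , T⊆B , ∣T∣≡1+m
         ← ∃-sizedSubsetContaining _ (∈fibre⁺ f refl) (∈fibre⁺ f (sym fi≡fj)) (s≤s 1≤m) large
  with T∈g , T∉f ← separatingFace {f = f} i∈T j∈T T⊆B ∣T∣≡1+m gi≢gj
  = ⊥-elim (T∉f (to (g≃f T) T∈g))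

fundamentalInflator⇒smallBlock≡1 : ∀ {m n} {f : Partition n} {i} →
  IsFundamentalInflator (sk m n) f → ∣ blockOf f i ∣ ≤ m → ∣ blockOf f i ∣ ≡ 1
fundamentalInflator⇒smallBlock≡1 {m} {n} {f} {i} (Y , f∈supp , finest) small with ∣ blockOf f i ∣ ≟ 1
... | yes ∣B∣≡1 = ∣B∣≡1
... | no ∣B∣≢1
  with j , j∈B , j≢i ← ∃-otherMember (∈fibre⁺ f refl) ∣B∣≢1
  with l , l∉f ← ∃-missedValue (∈fibre⁻ f j∈B) j≢i
  = ⊥-elim (l∉f j (begin
      f j               ≡⟨ isolate-≢ j≢i ⟨
      isolate f i l j   ≡⟨ finest (isolate f i l) isolate∈supp j i (∈fibre⁻ f j∈B) ⟩
      isolate f i l i   ≡⟨ isolate-≡ {f = f} {i} ⟩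
      l                 ∎))
  where
  open ≡-Reasoning
  isolate∈supp : InSupp (sk m n) Y (isolate f i l)
  isolate∈supp σ = ⇔.trans (inflate-sk-isolate small l∉f σ) (f∈supp σ)

proposition5p7 : (m n : ℕ) → 1 ≤ m → (Φ : Partition n) →
    IsFundamentalInflator (sk m n) Φ
      ⇔ ((i : Fin n) → (∣ blockOf Φ i ∣ ≡ 1) ⊎ (m < ∣ blockOf Φ i ∣))
proposition5p7 m n 1≤m Φ = mk⇔ blockSizes fundamental
  where
  blockSizes : IsFundamentalInflator (sk m n) Φ →
    (i : Fin n) → (∣ blockOf Φ i ∣ ≡ 1) ⊎ (m < ∣ blockOf Φ i ∣)
  blockSizes fund i with m <? ∣ blockOf Φ i ∣
  ... | yes large = inj₂ large
  ... | no ¬large = inj₁ (fundamentalInflator⇒smallBlock≡1 fund (≮⇒≥ ¬large))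
  fundamental : ((i : Fin n) → (∣ blockOf Φ i ∣ ≡ 1) ⊎ (m < ∣ blockOf Φ i ∣)) →
    IsFundamentalInflator (sk m n) Φ
  fundamental blocks =
    inflate (sk m n) Φ , (λ σ → ⇔.refl) , λ g g≃Φ → largeBlocks⇒finest 1≤m blocks g≃Φ
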